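{- Let $\mathcal{M}$ be a Minsky machine satisfying the standing assumptions below and let $m\ge1$. Then: (1) $S_m$ is computational and has capacity $m-1$. (2) If $p$ is a permutation of $[m]$ then $p(S_m)=S_m$ (where $p$ acts on tuples by permuting coordinates). (3) For any state $k$ and $\alpha,\beta$ with $\alpha+\beta<m$: $\mathrm{Config}(k,\alpha,\beta)\cap S_m\ne\emptyset$ if and only if $\mathrm{Config}(k,\alpha,\beta)\subseteq S_m$. (4) If $S_m\cap C^m\ne\emptyset$ then $S_m$ is halting.
   Context: Minsky machines. A Minsky machine $\mathcal{M}$ has states $\{0,1,\dots,N\}$ ($0$ is the halting state, $1$ the initial state), two registers $A,B$ holding values in $\mathbb{N}$, and a finite set of instructions of the forms $(i,R,j)$ and $(i,R,k,j)$ with $R\in\{A,B\}$. It acts on configurations $(s,\alpha,\beta)\in\{0,\dots,N\}\times\mathbb{N}\times\mathbb{N}$: $\mathcal{M}(i,\alpha,\beta)$ is $(j,\alpha+1,\beta)$ if $(i,A,j)\in\mathcal{M}$; $(j,\alpha,\beta+1)$ if $(i,B,j)\in\mathcal{M}$; $(j,\alpha-1,\beta)$ if $(i,A,k,j)\in\mathcal{M}$ and $\alpha\neq0$; $(j,\alpha,\beta-1)$ if $(i,B,k,j)\in\mathcal{M}$ and $\beta\ne 0$; $(k,\alpha,\beta)$ if $(i,A,k,j)\in\mathcal{M}$ and $\alpha=0$, or $(i,B,k,j)\in\mathcal{M}$ and $\beta=0$; and $(0,\alpha,\beta)$ if $i=0$. Standing assumptions on $\mathcal{M}$: it returns both registers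 to $0$ before halting; it has exactly one instruction $(i,\dots)$ for each non-halting state $i$; the instruction for state $1$ has the form $(1,R,s)$; and in the state graph (vertices the states, an edge $i\to j$ iff $\mathcal{M}(i,\alpha,\beta)=(j,\alpha',\beta')$ for some $\alpha,\beta,\alpha',\beta'$) every state is reachable from $1$ and $0$ is reachable from every state. The algebra. $A(\mathcal{M})=\{\langle i,c\rangle: 0\le i\le N,\ c\in\{\bullet,\times,0,A,B\}\}$. Put $X=\{\langle i,\times\rangle\}$, $D=\{\langle i,\bullet\rangle\}$, $C=A(\mathcal{M})\setminus(X\cup D)$, $Y=A(\mathcal{M})\setminus X$; $\mathrm{X}(\langle i,c\rangle)=\langle i,\times\rangle$, $\mathrm{State}(\langle i,c\rangle)=i$, $\mathrm{Content}(\langle i,c\rangle)=c$. Write "$(i,R,\dots,j)\in\mathcal{M}$" to mean $(i,R,j)\in\mathcal{M}$ or $(i,R,k,j)\in\mathcal{M}$ for some $k$. The operations (cases read in order, first applicable case applies): $\langle i,c\rangle\wedge\langle j,d\rangle$ is $\langle i,c\rangle$ if the two are equal, else $\langle\min(i,j),\times\rangle$. $M(x,y)$: $\langle j,R\rangle$ if $x=\langle i,\bullet\rangle, y=\langle i,0\rangle,(i,R,j)\in\mathcal{M}$; $\langle j,0\rangle$ if $x=\langle i,\bullet\rangle,y=\langle i,R\rangle,(i,R,k,j)\in\mathcal{M}$; $\langle j,\bullet\rangle$ if $x=\langle i,0\rangle,y=\langle i,\bullet\rangle,(i,R,j)\in\mathcal{M}$; $\langle j,\bullet\rangle$ if $x=\langle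 i,R\rangle,y=\langle i,\bullet\rangle,(i,R,k,j)\in\mathcal{M}$; $\langle j,c\rangle$ if $x=y=\langle i,c\rangle$, $c\ne\bullet$, $(i,R,\dots,j)\in\mathcal{M}$; $\langle j,\times\rangle$ if $\mathrm{State}(x)=\mathrm{State}(y)=i$ and $(i,R,\dots,j)\in\mathcal{M}$; otherwise $\mathrm{X}(y)$. $M'(x)$: $\langle k,c\rangle$ if $x=\langle i,c\rangle$, $(i,R,k,j)\in\mathcal{M}$, $c\neq R$; $\langle k,\times\rangle$ if $\mathrm{State}(x)=i$ and $(i,R,k,j)\in\mathcal{M}$; otherwise $\mathrm{X}(x)$. $I(x,y)$: $\langle1,\bullet\rangle$ if $x\in D$; $\langle 1,0\rangle$ if $y\in C$; otherwise $\langle1,\times\rangle$. $H(x)$: $\langle0,0\rangle$ if $x\in\{\langle0,0\rangle,\langle0,\bullet\rangle\}$, otherwise $\langle0,\times\rangle$. $N_0(x,y,z)$: $y$ if $x=\langle0,\bullet\rangle$ and $\mathrm{State}(y)=\mathrm{State}(z)$; $z$ if $x=\langle0,0\rangle$, $z\notin D$, $\mathrm{State}(y)=\mathrm{State}(z)$; otherwise $\mathrm{X}(y\wedge z)$. $S(x,y,z)$: $\langle1,0\rangle$ if $x=\langle1,0\rangle$, $\mathrm{State}(y)=\mathrm{State}(z)=1$ and $(\mathrm{Content}(y),\mathrm{Content}(z))\in\{(\bullet,0),(0,\bullet),(0,0)\}$; otherwise $\langle1,\times\rangle$. $N_\bullet(u,x,y,z)$, where the first four cases require $\mathrm{State}(x)=\mathrm{State}(y)=\mathrm{State}(z)$: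 $x$ if $x=y\notin X$; $x$ if $u\in D$, $y\in X$; $y$ if $u\in D$, $x\in X$; $z$ if $u\in D$, $z\in\{x,y\}$; otherwise $\mathrm{X}(x\wedge y\wedge z)$. $P(u,v,x,y)$: $x$ if $\mathrm{State}(u)=\mathrm{State}(v)$, else $y$. $\mathbb{A}(\mathcal{M})=\langle A(\mathcal{M});\wedge,M,M',I,H,N_0,S,N_\bullet,P\rangle$; operations act coordinatewise on powers. Notions. For $i\in[m]$ let $\sigma_i\in A(\mathcal{M})^m$ have $\sigma_i(i)=\langle1,\bullet\rangle$ and $\sigma_i(j)=\langle1,0\rangle$ for $j\ne i$; $S_m$ is the subuniverse of $A(\mathcal{M})^m$ generated by $\{\sigma_1,\dots,\sigma_m\}$. A tuple is synchronized if all its entries have the same state. A relation $R\le\mathbb{A}(\mathcal{M})^m$ is computational if all its elements are synchronized and each has at most one coordinate in $D$; it is halting if it contains some $r\in\{\langle0,0\rangle,\langle0,\bullet\rangle\}^m\setminus\{\langle0,0\rangle\}^m$; it has capacity $C$ if $|\{i\in[m]:\exists r\in R\cap Y^m,\ r(i)\in D\}|>C$. For a state $k$ and $\alpha+\beta<m$, $\mathrm{Config}(k,\alpha,\beta)$ is the set of all tuples obtained by permuting the coordinates of the tuple with one entry $\langle k,\bullet\rangle$, $\alpha$ entries $\langle k,A\rangle$, $\beta$ entries $\langle k,B\rangle$ and $m-\alpha-\beta-1$ entries $\langle k,0\rangle$. -}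

module Defs where

open import Data.Nat using (ℕ; zero; suc; _+_; _∸_; _<_; _≤ᵇ_)
open import Data.Fin using (Fin; toℕ) renaming (zero to fzero; suc to fsuc)
import Data.Fin.Properties as FinP
open import Data.Bool using (Bool; true; false; if_then_else_; _∧_; _∨_; not)
open import Data.Maybe using (Maybe; just; nothing)
open import Data.Product using (Σ; ∃; _×_; _,_; proj₁; proj₂)
open import Data.Sum using (_⊎_)
open import Data.Vec using (Vec; lookup; tabulate; toList; _⊛_) renaming (map to vmap)
import Data.List as L
open import Data.List.Relation.Binary.Permutation.Propositional using (_↭_)
open import Data.Fin.Permutation using (Permutation′; _⟨$⟩ʳ_)
open import Relation.Binary.PropositionalEquality using (_≡_; _≢_)
open import Relation.Binary.Construct.Closure.ReflexiveTransitive using (Star)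
open import Relation.Nullary using (¬_)
open import Relation.Nullary.Decidable using (⌊_⌋)
open import Function.Definitions using (Injective)

data Reg : Set where
  RA RB : Reg

-- instructions over a set of n states (Fin n)
--   inc R j   is  (i,R,j)
--   dec R k j is  (i,R,k,j)   (k: register is zero, j: register decremented)
data Instr (n : ℕ) : Set where
  inc : Reg → Fin n → Instr n
  dec : Reg → Fin n → Fin n → Instr n

-- A machine with states {0,1,…,N+1} (Fin (2+N)); state 0 = fzero halting,
-- state 1 = fsuc fzero initial.  prog k is THE (unique) instruction of the
-- non-halting state (fsuc k); the halting state has no instruction.
record Minsky : Set where
  field
    N    : ℕ
    prog : Fin (suc N) → Instr (suc (suc N))

  State : Set
  State = Fin (suc (suc N))

  s0 : State
  s0 = fzero

  s1 : State
  s1 = fsuc fzero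

  instr : State → Maybe (Instr (suc (suc N)))
  instr fzero    = nothing
  instr (fsuc k) = just (prog k)

  Config : Set
  Config = State × ℕ × ℕ

  step : Config → Config
  step (i , a , b) with instr i
  ... | nothing           = (s0 , a , b)
  ... | just (inc RA j)   = (j , suc a , b)
  ... | just (inc RB j)   = (j , a , suc b)
  ... | just (dec RA k j) with a
  ...   | zero  = (k , a , b)
  ...   | suc a' = (j , a' , b)
  step (i , a , b) | just (dec RB k j) with b
  ...   | zero  = (k , a , b)
  ...   | suc b' = (j , a , b')

  run : ℕ → Config → Config
  run zero    c = c
  run (suc n) c = run n (step c)

  Edge : State → State → Set
  Edge i j = Σ ℕ λ α → Σ ℕ λ β → Σ ℕ λ α' → Σ ℕ λ β' →
             step (i , α , β) ≡ (j , α' , β')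

  Reachable : State → State → Set
  Reachable = Star Edge

record Standing (𝓜 : Minsky) : Set where
  open Minsky 𝓜
  field
    returnsZero : ∀ n a b → run n (s1 , 0 , 0) ≡ (s0 , a , b) → (a ≡ 0) × (b ≡ 0)
    initInc     : ∃ λ R → ∃ λ s → prog fzero ≡ inc R s
    fromInit    : ∀ s → Reachable s1 s
    toHalt      : ∀ s → Reachable s s0

data Content : Set where
  bul crs zer cA cB : Content   -- •, ×, 0, A, B

eqC : Content → Content → Bool
eqC bul bul = true
eqC crs crs = true
eqC zer zer = true
eqC cA  cA  = true
eqC cB  cB  = true
eqC _   _   = false

regC : Reg → Content
regC RA = cA
regC RB = cB

module Alg (𝓜 : Minsky) where
  open Minsky 𝓜 public

  Elem : Set
  Elem = State × Content

  st : Elem → State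
  st = proj₁

  ct : Elem → Content
  ct = proj₂

  eqF : State → State → Bool
  eqF i j = ⌊ i FinP.≟ j ⌋

  eqS : Elem → Elem → Bool
  eqS x y = eqF (st x) (st y)

  eqE : Elem → Elem → Bool
  eqE x y = eqS x y ∧ eqC (ct x) (ct y)

  isD isX isC : Elem → Bool
  isD x = eqC (ct x) bul
  isX x = eqC (ct x) crs
  isC x = not (isD x) ∧ not (isX x)

  InX InD InC InY : Elem → Set
  InX x = ct x ≡ crs
  InD x = ct x ≡ bul
  InC x = ¬ InX x × ¬ InD x
  InY x = ¬ InX x

  Xf : Elem → Elem
  Xf x = (st x , crs)

  minF : State → State → State
  minF i j = if toℕ i ≤ᵇ toℕ j then i else j

  _⋀_ : Elem → Elem → Elem
  x ⋀ y = if eqE x y then x else (minF (st x) (st y) , crs)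

  private
    Mcase : State → Content → Content → Maybe (Instr (suc (suc N))) → Elem
    Mcase i c d nothing = (i , crs)
    Mcase i c d (just (inc R j)) =
      if eqC c bul ∧ eqC d zer then (j , regC R)
      else if eqC c zer ∧ eqC d bul then (j , bul)
      else if eqC c d ∧ not (eqC c bul) then (j , c)
      else (j , crs)
    Mcase i c d (just (dec R k j)) =
      if eqC c bul ∧ eqC d (regC R) then (j , zer)
      else if eqC c (regC R) ∧ eqC d bul then (j , bul)
      else if eqC c d ∧ not (eqC c bul) then (j , c)
      else (j , crs)

    M'case : Elem → Maybe (Instr (suc (suc N))) → Elem
    M'case x (just (dec R k j)) =
      if not (eqC (ct x) (regC R)) then (k , ct x) else (k , crs)
    M'case x _ = Xf x

  opM : Elem → Elem → Elem
  opM x y = if eqS x y then Mcase (st x) (ct x) (ct y) (instr (st x)) else Xf y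

  opM' : Elem → Elem
  opM' x = M'case x (instr (st x))

  opI : Elem → Elem → Elem
  opI x y = if isD x then (s1 , bul) else if isC y then (s1 , zer) else (s1 , crs)

  opH : Elem → Elem
  opH x = if eqE x (s0 , zer) ∨ eqE x (s0 , bul) then (s0 , zer) else (s0 , crs)

  opN0 : Elem → Elem → Elem → Elem
  opN0 x y z =
    if eqE x (s0 , bul) ∧ eqS y z then y
    else if eqE x (s0 , zer) ∧ not (isD z) ∧ eqS y z then z
    else Xf (y ⋀ z)

  okPair : Content → Content → Bool
  okPair bul zer = true
  okPair zer bul = true
  okPair zer zer = true
  okPair _   _   = false

  opS : Elem → Elem → Elem → Elem
  opS x y z =
    if eqE x (s1 , zer) ∧ eqF (st y) s1 ∧ eqF (st z) s1 ∧ okPair (ct y) (ct z)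
    then (s1 , zer) else (s1 , crs)

  opNb : Elem → Elem → Elem → Elem → Elem
  opNb u x y z =
    if eqS x y ∧ eqS y z then
      (if eqE x y ∧ not (isX x) then x
       else if isD u ∧ isX y then x
       else if isD u ∧ isX x then y
       else if isD u ∧ (eqE z x ∨ eqE z y) then z
       else Xf ((x ⋀ y) ⋀ z))
    else Xf ((x ⋀ y) ⋀ z)

  opP : Elem → Elem → Elem → Elem → Elem
  opP u v x y = if eqS u v then x else y

  Tuple : ℕ → Set
  Tuple m = Vec Elem m

  module _ {m : ℕ} where
    lift1 : (Elem → Elem) → Tuple m → Tuple m
    lift1 f a = vmap f a
    lift2 : (Elem → Elem → Elem) → Tuple m → Tuple m → Tuple m
    lift2 f a b = vmap f a ⊛ b
    lift3 : (Elem → Elem → Elem → Elem) → Tuple m → Tuple m → Tuple m → Tuple m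
    lift3 f a b c = vmap f a ⊛ b ⊛ c
    lift4 : (Elem → Elem → Elem → Elem → Elem) →
            Tuple m → Tuple m → Tuple m → Tuple m → Tuple m
    lift4 f a b c d = vmap f a ⊛ b ⊛ c ⊛ d

  σ : (m : ℕ) → Fin m → Tuple m
  σ m i = tabulate λ j → if ⌊ i FinP.≟ j ⌋ then (s1 , bul) else (s1 , zer)

  data InS (m : ℕ) : Tuple m → Set where
    gen   : (i : Fin m) → InS m (σ m i)
    cMeet : ∀ {a b} → InS m a → InS m b → InS m (lift2 _⋀_ a b)
    cM    : ∀ {a b} → InS m a → InS m b → InS m (lift2 opM a b)
    cM'   : ∀ {a} → InS m a → InS m (lift1 opM' a)
    cI    : ∀ {a b} → InS m a → InS m b → InS m (lift2 opI a b)
    cH    : ∀ {a} → InS m a → InS m (lift1 opH a)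
    cN0   : ∀ {a b c} → InS m a → InS m b → InS m c → InS m (lift3 opN0 a b c)
    cS    : ∀ {a b c} → InS m a → InS m b → InS m c → InS m (lift3 opS a b c)
    cNb   : ∀ {a b c d} → InS m a → InS m b → InS m c → InS m d →
            InS m (lift4 opNb a b c d)
    cP    : ∀ {a b c d} → InS m a → InS m b → InS m c → InS m d →
            InS m (lift4 opP a b c d)

  Synchronized : ∀ {m} → Tuple m → Set
  Synchronized r = ∀ i j → st (lookup r i) ≡ st (lookup r j)

  AtMostOneD : ∀ {m} → Tuple m → Set
  AtMostOneD r = ∀ i j → InD (lookup r i) → InD (lookup r j) → i ≡ j

  Computational : ∀ {m} → (Tuple m → Set) → Set
  Computational R = ∀ r → R r → Synchronized r × AtMostOneD r

  Halting : ∀ {m} → (Tuple m → Set) → Set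
  Halting R = ∃ λ r → R r
    × (∀ i → (lookup r i ≡ (s0 , zer)) ⊎ (lookup r i ≡ (s0 , bul)))
    × ¬ (∀ i → lookup r i ≡ (s0 , zer))

  -- |{ i ∈ [m] : ∃ r ∈ R ∩ Y^m, r(i) ∈ D }| > C, i.e. the set contains
  -- C+1 distinct indices
  HasCapacity : ∀ {m} → (Tuple m → Set) → ℕ → Set
  HasCapacity {m} R C = Σ (Fin (suc C) → Fin m) λ f →
    Injective _≡_ _≡_ f ×
    (∀ k → ∃ λ r → R r × (∀ i → InY (lookup r i)) × InD (lookup r (f k)))

  permute : ∀ {m} → Permutation′ m → Tuple m → Tuple m
  permute p r = tabulate λ i → lookup r (p ⟨$⟩ʳ i)

  Image : ∀ {m} → Permutation′ m → (Tuple m → Set) → Tuple m → Set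
  Image p R t = ∃ λ r → R r × t ≡ permute p r

  baseConfig : (m : ℕ) → State → ℕ → ℕ → L.List Elem
  baseConfig m k α β =
    (k , bul) L.∷ (L.replicate α (k , cA) L.++
                   (L.replicate β (k , cB) L.++
                    L.replicate (m ∸ α ∸ β ∸ 1) (k , zer)))

  InConfig : (m : ℕ) → State → ℕ → ℕ → Tuple m → Set
  InConfig m k α β r = toList r ↭ baseConfig m k α β

module Submission where

-- Every tuple of S_m satisfies three invariants, each preserved by the nine operations: all
-- entries share one state; at most one entry lies in D; and if all entries lie in C, then
-- S_m is halting.  The operations create neither a • nor an ordinary content out of nothing:
-- a result in D (resp. C) comes from an entry in D (resp. C) of a designated argument.  For
-- C the exceptions are H and N₀, where an ordinary result forces the first argument to
-- consist of ⟨0,0⟩ and ⟨0,•⟩ entries, so that argument either witnesses halting or is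
-- entirely ⟨0,0⟩; and N_•, where it is the uniqueness of • in u that makes an ordinary
-- result copy a single argument.  P on synchronized u, v returns x or y wholesale.
-- Coordinatewise operations commute with permutations of coordinates and permute the
-- generators among themselves, so S_m is permutation invariant, and any two elements of
-- Config(k,α,β) differ by a permutation.

open import Defs
open import Data.Bool using (Bool; true; false; T; not; _∧_; _∨_; if_then_else_)
open import Data.Bool.Properties using (T?; T-≡; if-float)
open import Data.Empty using (⊥-elim)
open import Data.Fin using (Fin; toℕ; cast)
open import Data.Fin.Permutation
  using (Permutation′; _⟨$⟩ʳ_; _⟨$⟩ˡ_; flip; inverseˡ; inverseʳ; _∘ₚ_; cast-id)
import Data.Fin.Properties as FinP
open import Data.Fin.Properties using (cast-involutive; all?; ¬∀⟶∃¬)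
import Data.List as List
open import Data.List.Properties using (length-++; length-replicate)
open import Data.List.Relation.Binary.Permutation.Homogeneous using (onIndices)
open import Data.List.Relation.Binary.Permutation.Propositional
  using (_↭_; ↭⇒↭ₛ; ↭-sym; ↭-reflexive; ↭-trans)
import Data.List.Relation.Binary.Permutation.Setoid.Properties as ↭ₛ
open import Data.Maybe using (Maybe; just; nothing)
open import Data.Nat using (ℕ; _≤_; _<_; _+_; _∸_; _≤ᵇ_; zero; suc; s≤s)
open import Data.Product using (∃; _×_; _,_; proj₁; proj₂)
open import Data.Product.Properties using (≡-dec)
open import Data.Sum using (_⊎_; inj₁; inj₂; [_,_]′)
open import Data.Vec using (Vec; _∷_; lookup; toList; fromList; tabulate; map; _⊛_)
  renaming (cast to castVec)
open import Data.Vec.Properties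
  using (lookup-map; lookup-⊛; lookup∘tabulate; tabulate∘lookup; tabulate-cong;
         length-toList; toList-cast; toList∘fromList)
open import Function.Base using (id; _∘_; _∘′_; _$_; case_of_)
open import Function.Bundles using (_⇔_; mk⇔; Equivalence)
open import Relation.Binary.Definitions using (DecidableEquality)
open import Relation.Binary.PropositionalEquality
open import Relation.Nullary using (¬_; Dec; yes; no)
open import Relation.Nullary.Decidable using (⌊_⌋; toWitness; map′)

lookup-ext : ∀ {A : Set} {n} {u v : Vec A n} → (∀ i → lookup u i ≡ lookup v i) → u ≡ v
lookup-ext {u = u} {v} u≗v = begin
  u                   ≡⟨ tabulate∘lookup u ⟨
  tabulate (lookup u) ≡⟨ tabulate-cong u≗v ⟩
  tabulate (lookup v) ≡⟨ tabulate∘lookup v ⟩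
  v                   ∎
  where open ≡-Reasoning

lookup-map-⊛ : ∀ {A B C : Set} {n} (f : A → B → C) xs ys (i : Fin n) →
               lookup (map f xs ⊛ ys) i ≡ f (lookup xs i) (lookup ys i)
lookup-map-⊛ f xs ys i = trans (lookup-⊛ i (map f xs) ys) (cong (_$ lookup ys i) (lookup-map i f xs))

lookup-map-⊛-⊛ : ∀ {A B C D : Set} {n} (f : A → B → C → D) xs ys zs (i : Fin n) →
                 lookup (map f xs ⊛ ys ⊛ zs) i ≡ f (lookup xs i) (lookup ys i) (lookup zs i)
lookup-map-⊛-⊛ f xs ys zs i =
  trans (lookup-⊛ i (map f xs ⊛ ys) zs) (cong (_$ lookup zs i) (lookup-map-⊛ f xs ys i))

lookup-map-⊛-⊛-⊛ : ∀ {A B C D E : Set} {n} (f : A → B → C → D → E) xs ys zs ws (i : Fin n) →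
                   lookup (map f xs ⊛ ys ⊛ zs ⊛ ws) i
                   ≡ f (lookup xs i) (lookup ys i) (lookup zs i) (lookup ws i)
lookup-map-⊛-⊛-⊛ f xs ys zs ws i =
  trans (lookup-⊛ i (map f xs ⊛ ys ⊛ zs) ws) (cong (_$ lookup ws i) (lookup-map-⊛-⊛ f xs ys zs i))

reindex : ∀ {A : Set} {m} → Permutation′ m → Vec A m → Vec A m
reindex π v = tabulate λ i → lookup v (π ⟨$⟩ʳ i)

lookup-reindex : ∀ {A : Set} {m} (π : Permutation′ m) (v : Vec A m) i →
                 lookup (reindex π v) i ≡ lookup v (π ⟨$⟩ʳ i)
lookup-reindex π v = lookup∘tabulate _

module _ {A B : Set} {m} (π : Permutation′ m) where

  reindex-map : ∀ (f : A → B) v → reindex π (map f v) ≡ map f (reindex π v)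
  reindex-map f v = lookup-ext λ i → begin
    lookup (reindex π (map f v)) i ≡⟨ lookup-reindex π (map f v) i ⟩
    lookup (map f v) (π ⟨$⟩ʳ i)    ≡⟨ lookup-map _ f v ⟩
    f (lookup v (π ⟨$⟩ʳ i))        ≡⟨ cong f (lookup-reindex π v i) ⟨
    f (lookup (reindex π v) i)     ≡⟨ lookup-map i f (reindex π v) ⟨
    lookup (map f (reindex π v)) i ∎
    where open ≡-Reasoning

  reindex-⊛ : ∀ (fs : Vec (A → B) m) xs → reindex π (fs ⊛ xs) ≡ (reindex π fs ⊛ reindex π xs)
  reindex-⊛ fs xs = lookup-ext λ i → begin
    lookup (reindex π (fs ⊛ xs)) i                    ≡⟨ lookup-reindex π (fs ⊛ xs) i ⟩
    lookup (fs ⊛ xs) (π ⟨$⟩ʳ i)                       ≡⟨ lookup-⊛ _ fs xs ⟩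
    lookup fs (π ⟨$⟩ʳ i) (lookup xs (π ⟨$⟩ʳ i))        ≡⟨ cong₂ _$_ (lookup-reindex π fs i)
                                                                   (lookup-reindex π xs i) ⟨
    lookup (reindex π fs) i (lookup (reindex π xs) i) ≡⟨ lookup-⊛ i (reindex π fs) (reindex π xs) ⟨
    lookup (reindex π fs ⊛ reindex π xs) i            ∎
    where open ≡-Reasoning

module _ {m} (π : Permutation′ m) where

  reindex-map-⊛ : ∀ {A B C : Set} (f : A → B → C) xs ys →
                  reindex π (map f xs ⊛ ys) ≡ (map f (reindex π xs) ⊛ reindex π ys)
  reindex-map-⊛ f xs ys =
    trans (reindex-⊛ π (map f xs) ys) (cong (_⊛ reindex π ys) (reindex-map π f xs))

  reindex-map-⊛-⊛ : ∀ {A B C D : Set} (f : A → B → C → D) xs ys zs →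
                    reindex π (map f xs ⊛ ys ⊛ zs)
                    ≡ (map f (reindex π xs) ⊛ reindex π ys ⊛ reindex π zs)
  reindex-map-⊛-⊛ f xs ys zs =
    trans (reindex-⊛ π (map f xs ⊛ ys) zs) (cong (_⊛ reindex π zs) (reindex-map-⊛ f xs ys))

  reindex-map-⊛-⊛-⊛ : ∀ {A B C D E : Set} (f : A → B → C → D → E) xs ys zs ws →
                      reindex π (map f xs ⊛ ys ⊛ zs ⊛ ws)
                      ≡ (map f (reindex π xs) ⊛ reindex π ys ⊛ reindex π zs ⊛ reindex π ws)
  reindex-map-⊛-⊛-⊛ f xs ys zs ws =
    trans (reindex-⊛ π (map f xs ⊛ ys ⊛ zs) ws) (cong (_⊛ reindex π ws) (reindex-map-⊛-⊛ f xs ys zs))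

  reindex-flip : ∀ {A : Set} (v : Vec A m) → reindex π (reindex (flip π) v) ≡ v
  reindex-flip v = lookup-ext λ i → begin
    lookup (reindex π (reindex (flip π) v)) i ≡⟨ lookup-reindex π (reindex (flip π) v) i ⟩
    lookup (reindex (flip π) v) (π ⟨$⟩ʳ i)    ≡⟨ lookup-reindex (flip π) v (π ⟨$⟩ʳ i) ⟩
    lookup v (π ⟨$⟩ˡ (π ⟨$⟩ʳ i))               ≡⟨ cong (lookup v) (inverseˡ π) ⟩
    lookup v i                                ∎
    where open ≡-Reasoning

lookup-toList : ∀ {A : Set} {n} (v : Vec A n) i →
                List.lookup (toList v) i ≡ lookup v (cast (length-toList v) i)
lookup-toList (x ∷ v) Fin.zero    = refl
lookup-toList (x ∷ v) (Fin.suc i) = lookup-toList v i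

-- onIndices relabels list positions; the casts translate them into vector indices.
toList-↭⇒reindexing : ∀ {A : Set} {m} (u v : Vec A m) → toList u ↭ toList v →
                      ∃ λ (π : Permutation′ m) → ∀ i → lookup v i ≡ lookup u (π ⟨$⟩ʳ i)
toList-↭⇒reindexing {A} u v u↭v = π , λ i → begin
  lookup v i                                ≡⟨ cong (lookup v) (cast-involutive (length-toList v) _ i) ⟨
  lookup v (cast (length-toList v) (toV i)) ≡⟨ lookup-toList v (toV i) ⟨
  List.lookup (toList v) (toV i)            ≡⟨ onIndices-lookup v↭u (toV i) ⟩
  List.lookup (toList u) (ρ ⟨$⟩ʳ toV i)     ≡⟨ lookup-toList u (ρ ⟨$⟩ʳ toV i) ⟩
  lookup u (π ⟨$⟩ʳ i)                       ∎
  where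
  open ≡-Reasoning
  open ↭ₛ (setoid A) using (onIndices-lookup)
  v↭u = ↭⇒↭ₛ (↭-sym u↭v)
  ρ = onIndices v↭u
  toV = cast (sym (length-toList v))
  π : Permutation′ _
  π = cast-id (sym (length-toList v)) ∘ₚ ρ ∘ₚ cast-id (length-toList u)

config-length : ∀ α β m → α + β < m → suc (α + (β + (m ∸ α ∸ β ∸ 1))) ≡ m
config-length (suc α) β       (suc m) (s≤s α+β<m) = cong suc (config-length α β m α+β<m)
config-length zero    (suc β) (suc m) (s≤s β<m)   = cong suc (config-length zero β m β<m)
config-length zero    zero    (suc m) _           = refl

≡true⇒T : ∀ {b} → b ≡ true → T b
≡true⇒T = Equivalence.from T-≡

T-∧-split : ∀ a {b} → T (a ∧ b) → T a × T b
T-∧-split true t = _ , t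

T-∨-split : ∀ a {b} → T (a ∨ b) → T a ⊎ T b
T-∨-split true  _ = inj₁ _
T-∨-split false t = inj₂ t

_⇒ᵇ_ : Bool → Bool → Bool
a ⇒ᵇ b = not a ∨ b

⇒ᵇ-mp : ∀ {a b} → T (a ⇒ᵇ b) → T a → T b
⇒ᵇ-mp {true} a⇒b _ = a⇒b

eqC-sound : ∀ c d → T (eqC c d) → c ≡ d
eqC-sound bul bul _ = refl
eqC-sound crs crs _ = refl
eqC-sound zer zer _ = refl
eqC-sound cA  cA  _ = refl
eqC-sound cB  cB  _ = refl

eqC-refl : ∀ c → T (eqC c c)
eqC-refl bul = _
eqC-refl crs = _
eqC-refl zer = _
eqC-refl cA  = _
eqC-refl cB  = _

_≟ᶜ_ : DecidableEquality Content
c ≟ᶜ d = map′ (eqC-sound c d) (λ { refl → eqC-refl c }) (T? (eqC c d))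

AllContents : (Content → Set) → Set
AllContents P = P bul × P crs × P zer × P cA × P cB

allContents : ∀ {P} → AllContents P → ∀ c → P c
allContents (p , _)             bul = p
allContents (_ , p , _)         crs = p
allContents (_ , _ , p , _)     zer = p
allContents (_ , _ , _ , p , _) cA  = p
allContents (_ , _ , _ , _ , p) cB  = p

allContents² : ∀ {P : Content → Content → Set} →
               AllContents (λ c → AllContents (P c)) → ∀ c d → P c d
allContents² {P} t c = allContents {P c} (allContents {λ c → AllContents (P c)} t c)

Ordinary : Content → Set
Ordinary c = ¬ c ≡ crs × ¬ c ≡ bul

isBul isOrd : Content → Bool
isBul c = eqC c bul
isOrd c = not (eqC c bul) ∧ not (eqC c crs)

isOrd-complete : ∀ {c} → Ordinary c → T (isOrd c)
isOrd-complete {bul} (_ , c≢bul) = c≢bul refl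
isOrd-complete {crs} (c≢crs , _) = c≢crs refl
isOrd-complete {zer} _ = _
isOrd-complete {cA}  _ = _
isOrd-complete {cB}  _ = _

isOrd-sound : ∀ c → T (isOrd c) → Ordinary c
isOrd-sound zer _ = (λ ()) , (λ ())
isOrd-sound cA  _ = (λ ()) , (λ ())
isOrd-sound cB  _ = (λ ()) , (λ ())

Ordinary? : ∀ c → Dec (Ordinary c)
Ordinary? c = map′ (isOrd-sound c) isOrd-complete (T? (isOrd c))

-- The content part of M on two elements of the same state with instruction (i,R,j),
-- resp. (i,R,k,j); Defs keeps the corresponding helper of opM private.
incContent decContent : Reg → Content → Content → Content
incContent R c d =
  if eqC c bul ∧ eqC d zer then regC R
  else if eqC c zer ∧ eqC d bul then bul
  else if eqC c d ∧ not (eqC c bul) then c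
  else crs
decContent R c d =
  if eqC c bul ∧ eqC d (regC R) then zer
  else if eqC c (regC R) ∧ eqC d bul then bul
  else if eqC c d ∧ not (eqC c bul) then c
  else crs

ReflectsKind : Content → Content → Set
ReflectsKind e d = T (isBul e ⇒ᵇ isBul d) × T (isOrd e ⇒ᵇ isOrd d)

reflectsKind-bul : ∀ e d → ReflectsKind e d → e ≡ bul → d ≡ bul
reflectsKind-bul e d (d-bul , _) refl = eqC-sound d bul d-bul

reflectsKind-ord : ∀ e d → ReflectsKind e d → Ordinary e → Ordinary d
reflectsKind-ord e d (_ , e⇒d) e-ord = isOrd-sound d (⇒ᵇ-mp {isOrd e} {isOrd d} e⇒d (isOrd-complete e-ord))

-- Both are decided by evaluation on all 25 pairs of contents.
incContent-reflects : ∀ R c d → ReflectsKind (incContent R c d) d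
incContent-reflects RA = allContents² _
incContent-reflects RB = allContents² _

decContent-reflects : ∀ R c d → ReflectsKind (decContent R c d) d
decContent-reflects RA = allContents² _
decContent-reflects RB = allContents² _

module Invariants (𝓜 : Minsky) where
  open Alg 𝓜

  Instruction : Set
  Instruction = Instr (suc (suc N))

  eqF-sound : ∀ a b → T (eqF a b) → a ≡ b
  eqF-sound a b = toWitness

  eqE-sound : ∀ x y → T (eqE x y) → x ≡ y
  eqE-sound (a , c) (b , d) t with a FinP.≟ b
  ... | yes refl = cong (a ,_) (eqC-sound c d t)

  _≟ᵉ_ : DecidableEquality Elem
  _≟ᵉ_ = ≡-dec FinP._≟_ _≟ᶜ_

  InC? : ∀ x → Dec (InC x)
  InC? x = Ordinary? (ct x)

  InX⇒¬InD : ∀ x → InX x → ¬ InD x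
  InX⇒¬InD _ refl ()

  isD-∧-sound : ∀ u {b} → isD u ∧ b ≡ true → InD u
  isD-∧-sound u e = eqC-sound (ct u) bul (proj₁ (T-∧-split (isD u) (≡true⇒T e)))

  st-if : ∀ b {x y : Elem} {s} → st x ≡ s → st y ≡ s → st (if b then x else y) ≡ s
  st-if true  x≡s _ = x≡s
  st-if false _ y≡s = y≡s

  minF-idem : ∀ a → minF a a ≡ a
  minF-idem a with toℕ a ≤ᵇ toℕ a
  ... | true  = refl
  ... | false = refl

  minF-≡ : ∀ {a b} → a ≡ b → minF a b ≡ a
  minF-≡ {a} refl = minF-idem a

  Copies : Elem → Elem → Set
  Copies r x = ct r ≡ ct x ⊎ InX r

  copies-D : ∀ r x → Copies r x → InD r → InD x
  copies-D r x (inj₁ r≈x) r∈D = trans (sym r≈x) r∈D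
  copies-D r x (inj₂ r∈X) r∈D = ⊥-elim (InX⇒¬InD r r∈X r∈D)

  copies-C : ∀ r x → Copies r x → InC r → InC x
  copies-C r x (inj₁ r≈x) r∈C = subst Ordinary r≈x r∈C
  copies-C r x (inj₂ r∈X) r∈C = ⊥-elim (proj₁ r∈C r∈X)

  st-⋀ : ∀ x y → st (x ⋀ y) ≡ minF (st x) (st y)
  st-⋀ x y with eqE x y in e
  ... | false = refl
  ... | true with eqE-sound x y (≡true⇒T e)
  ...   | refl = sym (minF-idem (st x))

  ⋀-copies : ∀ x y → Copies (x ⋀ y) x
  ⋀-copies x y with eqE x y
  ... | true  = inj₁ refl
  ... | false = inj₂ refl

  ⋀-D : ∀ x y → InD (x ⋀ y) → InD x
  ⋀-D x y = copies-D (x ⋀ y) x (⋀-copies x y)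

  ⋀-C : ∀ x y → InC (x ⋀ y) → InC x
  ⋀-C x y = copies-C (x ⋀ y) x (⋀-copies x y)

  nextState : Maybe Instruction → State → State
  nextState nothing           a = a
  nextState (just (inc _ j))   _ = j
  nextState (just (dec _ _ j)) _ = j

  stepContent : Maybe Instruction → Content → Content → Content
  stepContent nothing            _ _ = crs
  stepContent (just (inc R _))   = incContent R
  stepContent (just (dec R _ _)) = decContent R

  stepContent-reflects : ∀ ins c d → ReflectsKind (stepContent ins c d) d
  stepContent-reflects nothing            _ _ = _
  stepContent-reflects (just (inc R _))   = incContent-reflects R
  stepContent-reflects (just (dec R _ _)) = decContent-reflects R

  pair-if³ : ∀ {j : State} b₁ b₂ b₃ {w x y z : Content} →
             (if b₁ then (j , w) else if b₂ then (j , x) else if b₃ then (j , y) else (j , z))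
             ≡ (j , (if b₁ then w else if b₂ then x else if b₃ then y else z))
  pair-if³ true  _     _     = refl
  pair-if³ false true  _     = refl
  pair-if³ false false true  = refl
  pair-if³ false false false = refl

  opM-unfold : ∀ a c b d → opM (a , c) (b , d)
               ≡ (if eqF a b then (nextState (instr a) a , stepContent (instr a) c d) else (b , crs))
  opM-unfold a c b d with eqF a b
  ... | false = refl
  ... | true with instr a
  ...   | nothing          = refl
  ...   | just (inc R j)   =
    pair-if³ (eqC c bul ∧ eqC d zer) (eqC c zer ∧ eqC d bul) (eqC c d ∧ not (eqC c bul))
  ...   | just (dec R k j) =
    pair-if³ (eqC c bul ∧ eqC d (regC R)) (eqC c (regC R) ∧ eqC d bul) (eqC c d ∧ not (eqC c bul))

  stateM : State → State → State
  stateM a b = if eqF a b then nextState (instr a) a else b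

  st-opM : ∀ x y → st (opM x y) ≡ stateM (st x) (st y)
  st-opM (a , c) (b , d) rewrite opM-unfold a c b d = if-float st (eqF a b)

  opM-D : ∀ x y → InD (opM x y) → InD y
  opM-D (a , c) (b , d) r∈D rewrite opM-unfold a c b d with eqF a b
  ... | true = reflectsKind-bul _ d (stepContent-reflects (instr a) c d) r∈D

  opM-C : ∀ x y → InC (opM x y) → InC y
  opM-C (a , c) (b , d) r∈C rewrite opM-unfold a c b d with eqF a b
  ... | true  = reflectsKind-ord _ d (stepContent-reflects (instr a) c d) r∈C
  ... | false = ⊥-elim (proj₁ r∈C refl)

  zeroState : Maybe Instruction → State → State
  zeroState (just (dec _ k _)) _ = k
  zeroState _                  a = a

  stateM' : State → State
  stateM' a = zeroState (instr a) a

  st-opM' : ∀ x → st (opM' x) ≡ stateM' (st x)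
  st-opM' (a , c) with instr a
  ... | nothing          = refl
  ... | just (inc _ _)   = refl
  ... | just (dec R k j) = st-if (not (eqC c (regC R))) refl refl

  opM'-copies : ∀ x → Copies (opM' x) x
  opM'-copies (a , c) with instr a
  ... | nothing          = inj₂ refl
  ... | just (inc _ _)   = inj₂ refl
  ... | just (dec R _ _) with not (eqC c (regC R))
  ...   | true  = inj₁ refl
  ...   | false = inj₂ refl

  opM'-D : ∀ x → InD (opM' x) → InD x
  opM'-D x = copies-D (opM' x) x (opM'-copies x)

  opM'-C : ∀ x → InC (opM' x) → InC x
  opM'-C x = copies-C (opM' x) x (opM'-copies x)

  st-opI : ∀ x y → st (opI x y) ≡ s1
  st-opI x y = st-if (isD x) refl (st-if (isC y) refl refl)

  opI-D : ∀ x y → InD (opI x y) → InD x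
  opI-D x y with isD x in e | isC y
  ... | true  | _     = λ _ → eqC-sound (ct x) bul (≡true⇒T e)
  ... | false | true  = λ ()
  ... | false | false = λ ()

  opI-C : ∀ x y → InC (opI x y) → InC y
  opI-C x y r∈C with isD x
  ... | true = ⊥-elim (proj₂ r∈C refl)
  ... | false with isC y in e
  ...   | true  = isOrd-sound (ct y) (≡true⇒T e)
  ...   | false = ⊥-elim (proj₁ r∈C refl)

  st-opH : ∀ x → st (opH x) ≡ s0
  st-opH x = st-if (eqE x (s0 , zer) ∨ eqE x (s0 , bul)) refl refl

  opH-¬D : ∀ x → ¬ InD (opH x)
  opH-¬D x with eqE x (s0 , zer) ∨ eqE x (s0 , bul)
  ... | true  = λ ()
  ... | false = λ ()

  opH-C : ∀ x → InC (opH x) → x ≡ (s0 , zer) ⊎ x ≡ (s0 , bul)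
  opH-C x r∈C with eqE x (s0 , zer) in e₀ | eqE x (s0 , bul) in e•
  ... | true  | _     = inj₁ (eqE-sound x _ (≡true⇒T e₀))
  ... | false | true  = inj₂ (eqE-sound x _ (≡true⇒T e•))
  ... | false | false = ⊥-elim (proj₁ r∈C refl)

  st-opS : ∀ x y z → st (opS x y z) ≡ s1
  st-opS x y z =
    st-if (eqE x (s1 , zer) ∧ eqF (st y) s1 ∧ eqF (st z) s1 ∧ okPair (ct y) (ct z)) refl refl

  opS-¬D : ∀ x y z → ¬ InD (opS x y z)
  opS-¬D x y z with eqE x (s1 , zer) ∧ eqF (st y) s1 ∧ eqF (st z) s1 ∧ okPair (ct y) (ct z)
  ... | true  = λ ()
  ... | false = λ ()

  opS-C : ∀ x y z → InC (opS x y z) → InC x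
  opS-C x y z r∈C with eqE x (s1 , zer) ∧ eqF (st y) s1 ∧ eqF (st z) s1 ∧ okPair (ct y) (ct z) in e
  ... | false = ⊥-elim (proj₁ r∈C refl)
  ... | true with eqE-sound x _ (proj₁ (T-∧-split (eqE x (s1 , zer)) (≡true⇒T e)))
  ...   | refl = r∈C

  opN0-cases : ∀ x y z →
      (x ≡ (s0 , bul) × st y ≡ st z × opN0 x y z ≡ y)
    ⊎ (x ≡ (s0 , zer) × ¬ InD z × st y ≡ st z × opN0 x y z ≡ z)
    ⊎ opN0 x y z ≡ Xf (y ⋀ z)
  opN0-cases x y z with eqE x (s0 , bul) ∧ eqS y z in e₁
  ... | true with T-∧-split (eqE x (s0 , bul)) (≡true⇒T e₁)
  ...   | x≈• , y≈z = inj₁ (eqE-sound x _ x≈• , eqF-sound (st y) (st z) y≈z , refl)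
  opN0-cases x y z | false with eqE x (s0 , zer) ∧ not (isD z) ∧ eqS y z in e₂
  ... | false = inj₂ (inj₂ refl)
  ... | true with T-∧-split (eqE x (s0 , zer)) (≡true⇒T e₂)
  ...   | x≈0 , t with T-∧-split (not (isD z)) t
  ...     | z∉D , y≈z = inj₂ (inj₁ ( eqE-sound x _ x≈0
                                   , (λ z∈D → subst (T ∘ not ∘ isBul) z∈D z∉D)
                                   , eqF-sound (st y) (st z) y≈z , refl))

  st-opN0 : ∀ x y z → st (opN0 x y z) ≡ minF (st y) (st z)
  st-opN0 x y z with opN0-cases x y z
  ... | inj₁ (_ , y≈z , r≡y)           = trans (cong st r≡y) (sym (minF-≡ y≈z))
  ... | inj₂ (inj₁ (_ , _ , y≈z , r≡z)) = trans (cong st r≡z) (trans (sym y≈z) (sym (minF-≡ y≈z)))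
  ... | inj₂ (inj₂ r≡X)                 = trans (cong st r≡X) (st-⋀ y z)

  opN0-D : ∀ x y z → InD (opN0 x y z) → InD x
  opN0-D x y z r∈D with opN0-cases x y z
  ... | inj₁ (refl , _)                 = refl
  ... | inj₂ (inj₁ (_ , z∉D , _ , r≡z)) = ⊥-elim (z∉D (subst InD r≡z r∈D))
  ... | inj₂ (inj₂ r≡X)                 = ⊥-elim (InX⇒¬InD (opN0 x y z) (cong ct r≡X) r∈D)

  opN0-C : ∀ x y z → InC (opN0 x y z) →
           (x ≡ (s0 , bul) × opN0 x y z ≡ y) ⊎ (x ≡ (s0 , zer) × opN0 x y z ≡ z)
  opN0-C x y z r∈C with opN0-cases x y z
  ... | inj₁ (x≈• , _ , r≡y)            = inj₁ (x≈• , r≡y)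
  ... | inj₂ (inj₁ (x≈0 , _ , _ , r≡z)) = inj₂ (x≈0 , r≡z)
  ... | inj₂ (inj₂ r≡X)                 = ⊥-elim (proj₁ r∈C (cong ct r≡X))

  st-⋀⋀ : ∀ x y z → st (Xf ((x ⋀ y) ⋀ z)) ≡ minF (minF (st x) (st y)) (st z)
  st-⋀⋀ x y z = trans (st-⋀ (x ⋀ y) z) (cong (λ s → minF s (st z)) (st-⋀ x y))

  st-opNb : ∀ u x y z → st (opNb u x y z) ≡ minF (minF (st x) (st y)) (st z)
  st-opNb u x y z with eqS x y ∧ eqS y z in e
  ... | false = st-⋀⋀ x y z
  ... | true with T-∧-split (eqS x y) (≡true⇒T e)
  ...   | x≈y , y≈z =
    st-if (eqE x y ∧ not (isX x)) x≈min (st-if (isD u ∧ isX y) x≈min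
      (st-if (isD u ∧ isX x) (trans (sym sx≡sy) x≈min)
        (st-if (isD u ∧ (eqE z x ∨ eqE z y)) (trans (sym (trans sx≡sy sy≡sz)) x≈min)
          (st-⋀⋀ x y z))))
    where
    sx≡sy = eqF-sound (st x) (st y) x≈y
    sy≡sz = eqF-sound (st y) (st z) y≈z
    x≈min : st x ≡ minF (minF (st x) (st y)) (st z)
    x≈min = sym (trans (cong (λ s → minF s (st z)) (minF-≡ sx≡sy)) (minF-≡ (trans sx≡sy sy≡sz)))

  opNb-cases : ∀ u x y z →
      (opNb u x y z ≡ x × x ≡ y)
    ⊎ (InD u × (opNb u x y z ≡ x ⊎ opNb u x y z ≡ y))
    ⊎ InX (opNb u x y z)
  opNb-cases u x y z with eqS x y ∧ eqS y z
  ... | false = inj₂ (inj₂ refl)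
  ... | true with eqE x y ∧ not (isX x) in e₁
  ...   | true = inj₁ (refl , eqE-sound x y (proj₁ (T-∧-split (eqE x y) (≡true⇒T e₁))))
  ...   | false with isD u ∧ isX y in e₂
  ...     | true = inj₂ (inj₁ (isD-∧-sound u e₂ , inj₁ refl))
  ...     | false with isD u ∧ isX x in e₃
  ...       | true = inj₂ (inj₁ (isD-∧-sound u e₃ , inj₂ refl))
  ...       | false with isD u ∧ (eqE z x ∨ eqE z y) in e₄
  ...         | false = inj₂ (inj₂ refl)
  ...         | true with T-∨-split (eqE z x) (proj₂ (T-∧-split (isD u) (≡true⇒T e₄)))
  ...           | inj₁ z≈x = inj₂ (inj₁ (isD-∧-sound u e₄ , inj₁ (eqE-sound z x z≈x)))
  ...           | inj₂ z≈y = inj₂ (inj₁ (isD-∧-sound u e₄ , inj₂ (eqE-sound z y z≈y)))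

  opNb-D : ∀ u x y z → InD (opNb u x y z) → (InD x × InD y) ⊎ (InD u × (InD x ⊎ InD y))
  opNb-D u x y z r∈D with opNb-cases u x y z
  ... | inj₁ (r≡x , x≡y)             = inj₁ (subst InD r≡x r∈D , subst InD (trans r≡x x≡y) r∈D)
  ... | inj₂ (inj₁ (u∈D , inj₁ r≡x)) = inj₂ (u∈D , inj₁ (subst InD r≡x r∈D))
  ... | inj₂ (inj₁ (u∈D , inj₂ r≡y)) = inj₂ (u∈D , inj₂ (subst InD r≡y r∈D))
  ... | inj₂ (inj₂ r∈X)              = ⊥-elim (InX⇒¬InD (opNb u x y z) r∈X r∈D)

  opNb-C : ∀ u x y z → InC (opNb u x y z) →
           (opNb u x y z ≡ x × x ≡ y) ⊎ (InD u × (opNb u x y z ≡ x ⊎ opNb u x y z ≡ y))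
  opNb-C u x y z r∈C with opNb-cases u x y z
  ... | inj₁ r≡x≡y      = inj₁ r≡x≡y
  ... | inj₂ (inj₁ r∈xy) = inj₂ r∈xy
  ... | inj₂ (inj₂ r∈X)  = ⊥-elim (proj₁ r∈C r∈X)

  st-opP : ∀ u v x y → st (opP u v x y) ≡ (if eqS u v then st x else st y)
  st-opP u v x y = if-float st (eqS u v)

  module _ {m : ℕ} where

    lookup-σ : ∀ i j → lookup (σ m i) j ≡ (if ⌊ i FinP.≟ j ⌋ then (s1 , bul) else (s1 , zer))
    lookup-σ i = lookup∘tabulate _

    σ-self : ∀ i → lookup (σ m i) i ≡ (s1 , bul)
    σ-self i rewrite lookup-σ i i with i FinP.≟ i
    ... | yes _   = refl
    ... | no i≢i = ⊥-elim (i≢i refl)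

    σ-D : ∀ i j → InD (lookup (σ m i) j) → i ≡ j
    σ-D i j σᵢⱼ∈D rewrite lookup-σ i j with i FinP.≟ j
    ... | yes i≡j = i≡j

    σ-Y : ∀ i j → InY (lookup (σ m i) j)
    σ-Y i j rewrite lookup-σ i j with ⌊ i FinP.≟ j ⌋
    ... | true  = λ ()
    ... | false = λ ()

    σ-relabel : ∀ (π : Permutation′ m) i j → lookup (σ m i) (π ⟨$⟩ʳ j) ≡ lookup (σ m (π ⟨$⟩ˡ i)) j
    σ-relabel π i j rewrite lookup-σ i (π ⟨$⟩ʳ j) | lookup-σ (π ⟨$⟩ˡ i) j
      with i FinP.≟ π ⟨$⟩ʳ j | π ⟨$⟩ˡ i FinP.≟ j
    ... | yes _    | yes _    = refl
    ... | no _     | no _     = refl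
    ... | yes i≡πj | no πi≢j = ⊥-elim (πi≢j (trans (cong (π ⟨$⟩ˡ_) i≡πj) (inverseˡ π)))
    ... | no i≢πj | yes πi≡j = ⊥-elim (i≢πj (trans (sym (inverseʳ π)) (cong (π ⟨$⟩ʳ_) πi≡j)))

    SynchronizedAt : State → Tuple m → Set
    SynchronizedAt s r = ∀ i → st (lookup r i) ≡ s

    record Synced (r : Tuple m) : Set where
      constructor synced
      field
        state    : State
        at-state : SynchronizedAt state r

    synced⇒synchronized : ∀ {r} → Synced r → Synchronized r
    synced⇒synchronized (synced _ r≈s) i j = trans (r≈s i) (sym (r≈s j))

    synced₁ : ∀ f {a} (g : State → State) → (∀ x → st (f x) ≡ g (st x)) →
              Synced a → Synced (lift1 f a)
    synced₁ f {a} g st-f (synced s a≈s) =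
      synced (g s) λ i → trans (cong st (lookup-map i f a)) (trans (st-f _) (cong g (a≈s i)))

    synced₂ : ∀ f {a b} (g : State → State → State) → (∀ x y → st (f x y) ≡ g (st x) (st y)) →
              Synced a → Synced b → Synced (lift2 f a b)
    synced₂ f {a} {b} g st-f (synced s a≈s) (synced t b≈t) =
      synced (g s t) λ i →
        trans (cong st (lookup-map-⊛ f a b i)) (trans (st-f _ _) (cong₂ g (a≈s i) (b≈t i)))

    synced₃ : ∀ f {a b c} (g : State → State → State → State) →
              (∀ x y z → st (f x y z) ≡ g (st x) (st y) (st z)) →
              Synced a → Synced b → Synced c → Synced (lift3 f a b c)
    synced₃ f {a} {b} {c} g st-f (synced s a≈s) (synced t b≈t) (synced u c≈u) =
      synced (g s t u) λ i →
        trans (cong st (lookup-map-⊛-⊛ f a b c i)) (trans (st-f _ _ _) (g-cong (a≈s i) (b≈t i) (c≈u i)))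
      where
      g-cong : ∀ {p q r} → p ≡ s → q ≡ t → r ≡ u → g p q r ≡ g s t u
      g-cong refl refl refl = refl

    synced₄ : ∀ f {a b c d} (g : State → State → State → State → State) →
              (∀ w x y z → st (f w x y z) ≡ g (st w) (st x) (st y) (st z)) →
              Synced a → Synced b → Synced c → Synced d → Synced (lift4 f a b c d)
    synced₄ f {a} {b} {c} {d} g st-f (synced s a≈s) (synced t b≈t) (synced u c≈u) (synced v d≈v) =
      synced (g s t u v) λ i →
        trans (cong st (lookup-map-⊛-⊛-⊛ f a b c d i))
              (trans (st-f _ _ _ _) (g-cong (a≈s i) (b≈t i) (c≈u i) (d≈v i)))
      where
      g-cong : ∀ {p q r o} → p ≡ s → q ≡ t → r ≡ u → o ≡ v → g p q r o ≡ g s t u v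
      g-cong refl refl refl refl = refl

    InS⇒synced : ∀ {r} → InS m r → Synced r
    InS⇒synced (gen i)        = synced s1 λ j → trans (cong st (lookup-σ i j)) (st-if ⌊ i FinP.≟ j ⌋ refl refl)
    InS⇒synced (cMeet da db)  = synced₂ _⋀_ minF st-⋀ (InS⇒synced da) (InS⇒synced db)
    InS⇒synced (cM da db)     = synced₂ opM stateM st-opM (InS⇒synced da) (InS⇒synced db)
    InS⇒synced (cM' da)       = synced₁ opM' stateM' st-opM' (InS⇒synced da)
    InS⇒synced (cI da db)     = synced₂ opI (λ _ _ → s1) st-opI (InS⇒synced da) (InS⇒synced db)
    InS⇒synced (cH da)        = synced₁ opH (λ _ → s0) st-opH (InS⇒synced da)
    InS⇒synced (cN0 da db dc) =
      synced₃ opN0 (λ _ → minF) st-opN0 (InS⇒synced da) (InS⇒synced db) (InS⇒synced dc)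
    InS⇒synced (cS da db dc)  =
      synced₃ opS (λ _ _ _ → s1) st-opS (InS⇒synced da) (InS⇒synced db) (InS⇒synced dc)
    InS⇒synced (cNb da db dc dd) =
      synced₄ opNb (λ _ x y z → minF (minF x y) z) st-opNb
              (InS⇒synced da) (InS⇒synced db) (InS⇒synced dc) (InS⇒synced dd)
    InS⇒synced (cP da db dc dd) =
      synced₄ opP (λ u v x y → if eqF u v then x else y) st-opP
              (InS⇒synced da) (InS⇒synced db) (InS⇒synced dc) (InS⇒synced dd)

    lookup-opP : ∀ {u v} x y (su : Synced u) (sv : Synced v) i →
                 lookup (lift4 opP u v x y) i
                 ≡ (if eqF (Synced.state su) (Synced.state sv) then lookup x i else lookup y i)
    lookup-opP {u} {v} x y (synced s u≈s) (synced t v≈t) i =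
      trans (lookup-map-⊛-⊛-⊛ opP u v x y i)
            (cong (λ b → if b then lookup x i else lookup y i) (cong₂ eqF (u≈s i) (v≈t i)))

    opP-selects : ∀ {u v x y} → Synced u → Synced v →
                  lift4 opP u v x y ≡ x ⊎ lift4 opP u v x y ≡ y
    opP-selects {x = x} {y} su sv with eqF (Synced.state su) (Synced.state sv) | lookup-opP x y su sv
    ... | true  | entries = inj₁ (lookup-ext entries)
    ... | false | entries = inj₂ (lookup-ext entries)

    atMostOneD-reflect : ∀ (r a : Tuple m) → (∀ i → InD (lookup r i) → InD (lookup a i)) →
                         AtMostOneD a → AtMostOneD r
    atMostOneD-reflect r a r⇒a a-unique i j rᵢ rⱼ = a-unique i j (r⇒a i rᵢ) (r⇒a j rⱼ)

    noD⇒atMostOneD : ∀ (r : Tuple m) → (∀ i → ¬ InD (lookup r i)) → AtMostOneD r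
    noD⇒atMostOneD r noD i _ rᵢ _ = ⊥-elim (noD i rᵢ)

    atMostOneD-opNb : ∀ (u x y z : Tuple m) → AtMostOneD u → AtMostOneD x → AtMostOneD y →
                      AtMostOneD (lift4 opNb u x y z)
    atMostOneD-opNb u x y z u-unique x-unique y-unique i j rᵢ rⱼ = combine (D-at i rᵢ) (D-at j rⱼ)
      where
      D-at : ∀ i → InD (lookup (lift4 opNb u x y z) i) → _
      D-at i = opNb-D (lookup u i) (lookup x i) (lookup y i) (lookup z i)
               ∘′ subst InD (lookup-map-⊛-⊛-⊛ opNb u x y z i)
      combine : _ → _ → i ≡ j
      combine (inj₁ (xᵢ , _))      (inj₁ (xⱼ , _))      = x-unique i j xᵢ xⱼ
      combine (inj₁ (xᵢ , _))      (inj₂ (_ , inj₁ xⱼ)) = x-unique i j xᵢ xⱼ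
      combine (inj₁ (_ , yᵢ))      (inj₂ (_ , inj₂ yⱼ)) = y-unique i j yᵢ yⱼ
      combine (inj₂ (_ , inj₁ xᵢ)) (inj₁ (xⱼ , _))      = x-unique i j xᵢ xⱼ
      combine (inj₂ (_ , inj₂ yᵢ)) (inj₁ (_ , yⱼ))      = y-unique i j yᵢ yⱼ
      combine (inj₂ (uᵢ , _))      (inj₂ (uⱼ , _))      = u-unique i j uᵢ uⱼ

    InS⇒atMostOneD : ∀ {r} → InS m r → AtMostOneD r
    InS⇒atMostOneD (gen i) j k j∈D k∈D = trans (sym (σ-D i j j∈D)) (σ-D i k k∈D)
    InS⇒atMostOneD (cMeet {a} {b} da db) = atMostOneD-reflect (lift2 _⋀_ a b) a
      (λ i → ⋀-D (lookup a i) (lookup b i) ∘′ subst InD (lookup-map-⊛ _⋀_ a b i))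
      (InS⇒atMostOneD da)
    InS⇒atMostOneD (cM {a} {b} da db) = atMostOneD-reflect (lift2 opM a b) b
      (λ i → opM-D (lookup a i) (lookup b i) ∘′ subst InD (lookup-map-⊛ opM a b i))
      (InS⇒atMostOneD db)
    InS⇒atMostOneD (cM' {a} da) = atMostOneD-reflect (lift1 opM' a) a
      (λ i → opM'-D (lookup a i) ∘′ subst InD (lookup-map i opM' a))
      (InS⇒atMostOneD da)
    InS⇒atMostOneD (cI {a} {b} da db) = atMostOneD-reflect (lift2 opI a b) a
      (λ i → opI-D (lookup a i) (lookup b i) ∘′ subst InD (lookup-map-⊛ opI a b i))
      (InS⇒atMostOneD da)
    InS⇒atMostOneD (cH {a} da) = noD⇒atMostOneD (lift1 opH a)
      (λ i → opH-¬D (lookup a i) ∘′ subst InD (lookup-map i opH a))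
    InS⇒atMostOneD (cN0 {a} {b} {c} da db dc) = atMostOneD-reflect (lift3 opN0 a b c) a
      (λ i → opN0-D (lookup a i) (lookup b i) (lookup c i) ∘′ subst InD (lookup-map-⊛-⊛ opN0 a b c i))
      (InS⇒atMostOneD da)
    InS⇒atMostOneD (cS {a} {b} {c} da db dc) = noD⇒atMostOneD (lift3 opS a b c)
      (λ i → opS-¬D (lookup a i) (lookup b i) (lookup c i) ∘′ subst InD (lookup-map-⊛-⊛ opS a b c i))
    InS⇒atMostOneD (cNb {u} {x} {y} {z} du dx dy dz) =
      atMostOneD-opNb u x y z (InS⇒atMostOneD du) (InS⇒atMostOneD dx) (InS⇒atMostOneD dy)
    InS⇒atMostOneD (cP {c = x} {d = y} du dv dx dy)
      with opP-selects {x = x} {y} (InS⇒synced du) (InS⇒synced dv)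
    ... | inj₁ r≡x rewrite r≡x = InS⇒atMostOneD dx
    ... | inj₂ r≡y rewrite r≡y = InS⇒atMostOneD dy

    AllOrdinary : Tuple m → Set
    AllOrdinary r = ∀ i → InC (lookup r i)

    HaltsIfOrdinary : Tuple m → Set
    HaltsIfOrdinary r = AllOrdinary r → Halting (InS m)

    haltsIfOrdinary-reflect : ∀ (r a : Tuple m) → (∀ i → InC (lookup r i) → InC (lookup a i)) →
                              HaltsIfOrdinary a → HaltsIfOrdinary r
    haltsIfOrdinary-reflect r a r⇒a a-halts r∈C = a-halts (λ i → r⇒a i (r∈C i))

    halting-or-allZero : ∀ {a} → InS m a →
                         (∀ i → lookup a i ≡ (s0 , zer) ⊎ lookup a i ≡ (s0 , bul)) →
                         Halting (InS m) ⊎ (∀ i → lookup a i ≡ (s0 , zer))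
    halting-or-allZero {a} a∈S a-final with all? (λ i → lookup a i ≟ᵉ (s0 , zer))
    ... | yes zeros = inj₂ zeros
    ... | no ¬zeros = inj₁ (a , a∈S , a-final , ¬zeros)

    halts-opH : ∀ {a} → InS m a → HaltsIfOrdinary a → HaltsIfOrdinary (lift1 opH a)
    halts-opH {a} a∈S a-halts r∈C =
      [ id , (λ zeros → a-halts λ i → subst InC (sym (zeros i)) ((λ ()) , (λ ()))) ]′
        (halting-or-allZero a∈S λ i → opH-C (lookup a i) (subst InC (lookup-map i opH a) (r∈C i)))

    halts-opN0 : ∀ {a} b c → InS m a → HaltsIfOrdinary c → HaltsIfOrdinary (lift3 opN0 a b c)
    halts-opN0 {a} b c a∈S c-halts r∈C =
      [ id , (λ zeros → c-halts λ i → c∈C i (zeros i)) ]′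
        (halting-or-allZero a∈S λ i → a-final (C-at i))
      where
      rᵢ∈C : ∀ i → InC (opN0 (lookup a i) (lookup b i) (lookup c i))
      rᵢ∈C i = subst InC (lookup-map-⊛-⊛ opN0 a b c i) (r∈C i)
      C-at : ∀ i → _
      C-at i = opN0-C (lookup a i) (lookup b i) (lookup c i) (rᵢ∈C i)
      a-final : ∀ {x y z} → (x ≡ (s0 , bul) × opN0 x y z ≡ y) ⊎ (x ≡ (s0 , zer) × opN0 x y z ≡ z) →
                x ≡ (s0 , zer) ⊎ x ≡ (s0 , bul)
      a-final (inj₁ (x≈• , _)) = inj₂ x≈•
      a-final (inj₂ (x≈0 , _)) = inj₁ x≈0
      c∈C : ∀ i → lookup a i ≡ (s0 , zer) → InC (lookup c i)
      c∈C i aᵢ≈0 with C-at i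
      ... | inj₁ (aᵢ≈• , _) = case trans (sym aᵢ≈•) aᵢ≈0 of λ ()
      ... | inj₂ (_ , r≡c)  = subst InC r≡c (rᵢ∈C i)

    -- If x is not all ordinary, say at p, the result is ordinary at p only thanks to uₚ ∈ D;
    -- since u has no other •, the result copies y everywhere else.
    halts-opNb : ∀ (u x y z : Tuple m) → AtMostOneD u → HaltsIfOrdinary x → HaltsIfOrdinary y →
                 HaltsIfOrdinary (lift4 opNb u x y z)
    halts-opNb u x y z u-unique x-halts y-halts r∈C with all? (InC? ∘ lookup x)
    ... | yes x∈C = x-halts x∈C
    ... | no x∉C  = y-halts (y∈C (¬∀⟶∃¬ m _ (InC? ∘ lookup x) x∉C))
      where
      rᵢ∈C : ∀ i → InC (opNb (lookup u i) (lookup x i) (lookup y i) (lookup z i))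
      rᵢ∈C i = subst InC (lookup-map-⊛-⊛-⊛ opNb u x y z i) (r∈C i)
      C-at : ∀ i → _
      C-at i = opNb-C (lookup u i) (lookup x i) (lookup y i) (lookup z i) (rᵢ∈C i)
      uₚ∈D : ∀ {p} → ¬ InC (lookup x p) → InD (lookup u p)
      uₚ∈D {p} xₚ∉C with C-at p
      ... | inj₁ (r≡x , _)       = ⊥-elim (xₚ∉C (subst InC r≡x (rᵢ∈C p)))
      ... | inj₂ (_ , inj₁ r≡x)  = ⊥-elim (xₚ∉C (subst InC r≡x (rᵢ∈C p)))
      ... | inj₂ (uₚ∈D , inj₂ _) = uₚ∈D
      y∈C : (∃ λ p → ¬ InC (lookup x p)) → AllOrdinary y
      y∈C (p , xₚ∉C) i with C-at i
      ... | inj₁ (r≡x , x≡y)    = subst InC (trans r≡x x≡y) (rᵢ∈C i)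
      ... | inj₂ (_ , inj₂ r≡y) = subst InC r≡y (rᵢ∈C i)
      ... | inj₂ (uᵢ∈D , inj₁ r≡x) with u-unique i p uᵢ∈D (uₚ∈D xₚ∉C)
      ...   | refl = ⊥-elim (xₚ∉C (subst InC r≡x (rᵢ∈C i)))

    InS⇒halts : ∀ {r} → InS m r → HaltsIfOrdinary r
    InS⇒halts (gen i) r∈C = ⊥-elim (proj₂ (subst InC (σ-self i) (r∈C i)) refl)
    InS⇒halts (cMeet {a} {b} da db) = haltsIfOrdinary-reflect (lift2 _⋀_ a b) a
      (λ i → ⋀-C (lookup a i) (lookup b i) ∘′ subst InC (lookup-map-⊛ _⋀_ a b i))
      (InS⇒halts da)
    InS⇒halts (cM {a} {b} da db) = haltsIfOrdinary-reflect (lift2 opM a b) b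
      (λ i → opM-C (lookup a i) (lookup b i) ∘′ subst InC (lookup-map-⊛ opM a b i))
      (InS⇒halts db)
    InS⇒halts (cM' {a} da) = haltsIfOrdinary-reflect (lift1 opM' a) a
      (λ i → opM'-C (lookup a i) ∘′ subst InC (lookup-map i opM' a))
      (InS⇒halts da)
    InS⇒halts (cI {a} {b} da db) = haltsIfOrdinary-reflect (lift2 opI a b) b
      (λ i → opI-C (lookup a i) (lookup b i) ∘′ subst InC (lookup-map-⊛ opI a b i))
      (InS⇒halts db)
    InS⇒halts (cH da) = halts-opH da (InS⇒halts da)
    InS⇒halts (cN0 {b = b} {c} da db dc) = halts-opN0 b c da (InS⇒halts dc)
    InS⇒halts (cS {a} {b} {c} da db dc) = haltsIfOrdinary-reflect (lift3 opS a b c) a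
      (λ i → opS-C (lookup a i) (lookup b i) (lookup c i) ∘′ subst InC (lookup-map-⊛-⊛ opS a b c i))
      (InS⇒halts da)
    InS⇒halts (cNb {u} {x} {y} {z} du dx dy dz) =
      halts-opNb u x y z (InS⇒atMostOneD du) (InS⇒halts dx) (InS⇒halts dy)
    InS⇒halts (cP {c = x} {d = y} du dv dx dy)
      with opP-selects {x = x} {y} (InS⇒synced du) (InS⇒synced dv)
    ... | inj₁ r≡x rewrite r≡x = InS⇒halts dx
    ... | inj₂ r≡y rewrite r≡y = InS⇒halts dy

    permute-σ : ∀ (π : Permutation′ m) i → permute π (σ m i) ≡ σ m (π ⟨$⟩ˡ i)
    permute-σ π i = lookup-ext λ j → trans (lookup-reindex π (σ m i) j) (σ-relabel π i j)

    InS-permute : ∀ π {r} → InS m r → InS m (permute π r)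
    InS-permute π (gen i) = subst (InS m) (sym (permute-σ π i)) (gen _)
    InS-permute π (cMeet {a} {b} da db) = subst (InS m) (sym (reindex-map-⊛ π _⋀_ a b))
      (cMeet (InS-permute π da) (InS-permute π db))
    InS-permute π (cM {a} {b} da db) = subst (InS m) (sym (reindex-map-⊛ π opM a b))
      (cM (InS-permute π da) (InS-permute π db))
    InS-permute π (cM' {a} da) = subst (InS m) (sym (reindex-map π opM' a))
      (cM' (InS-permute π da))
    InS-permute π (cI {a} {b} da db) = subst (InS m) (sym (reindex-map-⊛ π opI a b))
      (cI (InS-permute π da) (InS-permute π db))
    InS-permute π (cH {a} da) = subst (InS m) (sym (reindex-map π opH a))
      (cH (InS-permute π da))
    InS-permute π (cN0 {a} {b} {c} da db dc) = subst (InS m) (sym (reindex-map-⊛-⊛ π opN0 a b c))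
      (cN0 (InS-permute π da) (InS-permute π db) (InS-permute π dc))
    InS-permute π (cS {a} {b} {c} da db dc) = subst (InS m) (sym (reindex-map-⊛-⊛ π opS a b c))
      (cS (InS-permute π da) (InS-permute π db) (InS-permute π dc))
    InS-permute π (cNb {a} {b} {c} {d} da db dc dd) =
      subst (InS m) (sym (reindex-map-⊛-⊛-⊛ π opNb a b c d))
        (cNb (InS-permute π da) (InS-permute π db) (InS-permute π dc) (InS-permute π dd))
    InS-permute π (cP {a} {b} {c} {d} da db dc dd) =
      subst (InS m) (sym (reindex-map-⊛-⊛-⊛ π opP a b c d))
        (cP (InS-permute π da) (InS-permute π db) (InS-permute π dc) (InS-permute π dd))

    InS-↭ : ∀ {r r′} → InS m r → toList r ↭ toList r′ → InS m r′
    InS-↭ {r} {r′} r∈S r↭r′ with toList-↭⇒reindexing r r′ r↭r′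
    ... | π , entries =
      subst (InS m) (lookup-ext λ i → trans (lookup-reindex π r i) (sym (entries i))) (InS-permute π r∈S)

    config-nonempty : ∀ k α β → α + β < m → ∃ λ r → InConfig m k α β r
    config-nonempty k α β α+β<m =
        castVec base-length (fromList base)
      , ↭-reflexive (trans (toList-cast base-length _) (toList∘fromList base))
      where
      base = baseConfig m k α β
      zeros = List.replicate (m ∸ α ∸ β ∸ 1) (k , zer)
      base-length : List.length base ≡ m
      base-length = begin
        suc (List.length (List.replicate α (k , cA) List.++ (List.replicate β (k , cB) List.++ zeros)))
          ≡⟨ cong suc (length-++ (List.replicate α (k , cA))) ⟩
        suc (List.length (List.replicate α (k , cA)) + List.length (List.replicate β (k , cB) List.++ zeros))
          ≡⟨ cong suc (cong₂ _+_ (length-replicate α) (length-++ (List.replicate β (k , cB)))) ⟩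
        suc (α + (List.length (List.replicate β (k , cB)) + List.length zeros))
          ≡⟨ cong (λ n → suc (α + n)) (cong₂ _+_ (length-replicate β) (length-replicate (m ∸ α ∸ β ∸ 1))) ⟩
        suc (α + (β + (m ∸ α ∸ β ∸ 1)))
          ≡⟨ config-length α β m α+β<m ⟩
        m ∎
        where open ≡-Reasoning

lemma5p11 : (𝓜 : Minsky) → Standing 𝓜 → (m : ℕ) → 1 ≤ m →
    let open Alg 𝓜 in
      (Computational (InS m) × HasCapacity (InS m) (m ∸ 1))
    × (∀ (p : Permutation′ m) →
         (∀ t → Image p (InS m) t → InS m t) × (∀ t → InS m t → Image p (InS m) t))
    × (∀ (k : State) (α β : ℕ) → α + β < m →
         ((∃ λ r → InConfig m k α β r × InS m r) ⇔ (∀ r → InConfig m k α β r → InS m r)))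
    × ((∃ λ r → InS m r × (∀ i → InC (lookup r i))) → Halting (InS m))
lemma5p11 𝓜 _ m@(suc _) _ =
    (computational , capacity)
  , (λ π → (λ { t (r , r∈S , refl) → InS-permute π r∈S })
         , (λ t t∈S → permute (flip π) t , InS-permute (flip π) t∈S , sym (reindex-flip π t)))
  , (λ k α β α+β<m → mk⇔
       (λ { (r , r∈Config , r∈S) r′ r′∈Config → InS-↭ r∈S (↭-trans r∈Config (↭-sym r′∈Config)) })
       (λ Config⊆S → let r , r∈Config = config-nonempty k α β α+β<m in r , r∈Config , Config⊆S r r∈Config))
  , (λ { (r , r∈S , r∈C) → InS⇒halts r∈S r∈C })
  where
  open Alg 𝓜
  open Invariants 𝓜
  computational : Computational (InS m)
  computational r r∈S = synced⇒synchronized (InS⇒synced r∈S) , InS⇒atMostOneD r∈S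
  capacity : HasCapacity (InS m) (m ∸ 1)
  capacity = id , id , λ k → σ m k , gen k , σ-Y k , subst InD (sym (σ-self k)) refl
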